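{- Let $\pi\in\mathfrak{B}_n$, $1\le j\le n+1$ and $1\le i_1<i_2\le n+1$. Then (a) $d_v^+(i_1,j)\ne d_v^+(i_2,j)$ if and only if there exists exactly one positive square $\langle i',j'\rangle$ in $P_\pi$ with $j-1\le j'\le j$ and $i_1\le i'<i_2$; (b) $d_v^-(i_1,j)\ne d_v^-(i_2,j)$ if and only if there exists exactly one negative square $\langle i',j'\rangle$ in $P_\pi$ with $j-1\le j'\le j$ and $i_1\le i'<i_2$.
   Context: $\mathfrak{B}_n$ is the set of signed permutations $\pi=\pi_1\cdots\pi_n$ ($\pi_i\in\{\pm1,\dots,\pm n\}$, $|\pi_1|,\dots,|\pi_n|$ a permutation of $[n]$), $\pi_0=0$, inverse given by $\pi^{ -1}_{|\pi_i|}=\operatorname{sgn}(\pi_i)\,i$. Natural order: $\operatorname{des}^B(\pi)=|\{i\in\{0,\dots,n-1\}:\pi_i>\pi_{i+1}\}|$, $\operatorname{ides}^B(\pi)=\operatorname{des}^B(\pi^{ -1})$. The grid $P_\pi$ is an $n\times n$ array of squares (rows from top, columns from left); $\langle i,j\rangle$ is the square in row $i$, column $j$; $\langle i,|\pi_i|\rangle$ is a positive square if $\pi_i>0$, negative if $\pi_i<0$. Grid point $(i,j)$ ($1\le i,j\le n+1$) is the intersection of the $i$-th horizontal and $j$-th vertical grid lines. For $i,j\in[n+1]$, $\varphi_{(i,j)}(\pi)$ is the $\sigma\in\mathfrak{B}_{n+1}$ with $\sigma_i=j$, $\sigma_k=s(\pi_k)$ for $k<i$, $\sigma_k=s(\pi_{k-1})$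 for $k>i$, where $s(x)=x$ if $|x|<j$, $s(x)=x+1$ if $x\ge j$, $s(x)=x-1$ if $x\le-j$; $\overline{\varphi}_{(i,j)}(\pi)$ is the same with $\sigma_i=-j$. $d_v^+(i,j)=\operatorname{ides}^B(\varphi_{(i,j)}(\pi))-\operatorname{ides}^B(\pi)$ and $d_v^-(i,j)=\operatorname{ides}^B(\overline{\varphi}_{(i,j)}(\pi))-\operatorname{ides}^B(\pi)$. -}

module Defs where

open import Data.Nat as ℕ using (ℕ; zero; suc; _≤_; _<_; _∸_; _≡ᵇ_)
open import Data.Integer as ℤ using (ℤ; +_; -_; ∣_∣; _<?_; _≤?_)
open import Data.List using (List; []; _∷_; map; length; upTo)
open import Data.List.Relation.Binary.Permutation.Propositional using (_↭_)
open import Data.Product using (_×_; ∃!; _,_)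
open import Data.Bool using (if_then_else_)
open import Relation.Binary.PropositionalEquality using (_≡_)
open import Relation.Nullary.Decidable using (does)

-- A signed permutation of [n] is represented by its window
-- π₁ ⋯ πₙ as a list of integers; it is a signed permutation iff
-- |π₁|,…,|πₙ| is a permutation of 1,…,n.
IsSignedPerm : ℕ → List ℤ → Set
IsSignedPerm n xs = map ∣_∣ xs ↭ map suc (upTo n)

-- π_i (1-based), with the convention π₀ = 0.
at : List ℤ → ℕ → ℤ
at xs zero = + 0
at [] (suc i) = + 0
at (x ∷ xs) (suc zero) = x
at (x ∷ xs) (suc (suc i)) = at xs (suc i)

descentsFrom : ℤ → List ℤ → ℕ
descentsFrom prev [] = 0
descentsFrom prev (x ∷ xs) =
  (if does (x <? prev) then 1 else 0) ℕ.+ descentsFrom x xs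

desB : List ℤ → ℕ
desB xs = descentsFrom (+ 0) xs

invEntry : ℕ → ℕ → List ℤ → ℤ
invEntry k pos [] = + 0
invEntry k pos (x ∷ xs) =
  if ∣ x ∣ ≡ᵇ k
  then (if does (+ 0 ≤? x) then + pos else - (+ pos))
  else invEntry k (suc pos) xs

-- inverse signed permutation: π⁻¹_{|π_i|} = sgn(π_i) i
invB : List ℤ → List ℤ
invB xs = map (λ k → invEntry k 1 xs) (map suc (upTo (length xs)))

idesB : List ℤ → ℕ
idesB xs = desB (invB xs)

shift : ℕ → ℤ → ℤ
shift j x =
  if does (∣ x ∣ ℕ.<? j) then x
  else (if does (+ 0 ≤? x) then x ℤ.+ + 1 else x ℤ.- + 1)

insertAt : ℕ → ℤ → List ℤ → List ℤ
insertAt zero v xs = v ∷ xs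
insertAt (suc m) v [] = v ∷ []
insertAt (suc m) v (x ∷ xs) = x ∷ insertAt m v xs

-- φ_{(i,j)}(π) : σ_i = j, σ_k = s(π_k) (k<i), σ_k = s(π_{k-1}) (k>i)
φ : ℕ → ℕ → List ℤ → List ℤ
φ i j π = insertAt (i ∸ 1) (+ j) (map (shift j) π)

φbar : ℕ → ℕ → List ℤ → List ℤ
φbar i j π = insertAt (i ∸ 1) (- (+ j)) (map (shift j) π)

dvPlus : List ℤ → ℕ → ℕ → ℤ
dvPlus π i j = + idesB (φ i j π) ℤ.- + idesB π

dvMinus : List ℤ → ℕ → ℕ → ℤ
dvMinus π i j = + idesB (φbar i j π) ℤ.- + idesB π

-- ⟨i',j'⟩ is a positive square of P_π (π ∈ B_n): π_{i'} = j' > 0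
PosSquare : ℕ → List ℤ → ℕ → ℕ → Set
PosSquare n π i' j' = 1 ≤ i' × i' ≤ n × 1 ≤ j' × at π i' ≡ + j'

NegSquare : ℕ → List ℤ → ℕ → ℕ → Set
NegSquare n π i' j' = 1 ≤ i' × i' ≤ n × 1 ≤ j' × at π i' ≡ - (+ j')

InRegion : ℕ → ℕ → ℕ → ℕ → ℕ → Set
InRegion j i₁ i₂ i' j' = (j ∸ 1) ≤ j' × j' ≤ j × i₁ ≤ i' × i' < i₂

ExactlyOneSquare : (ℕ → ℕ → Set) → Set
ExactlyOneSquare P = ∃! _≡_ (λ (p : ℕ × ℕ) → let (a , b) = p in P a b)

module Submission where

-- The inverse of σ = φ_{(i,j)}(π) (or φ̄_{(i,j)}(π)) is π⁻¹ with shift i applied to every entry and ±i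
-- inserted at position j. As shift i is strictly monotone, σ⁻¹ has the descents of π⁻¹ except at the
-- positions j − 1 and j, where ±i is compared with shift i (π⁻¹_{j−1}) and with shift i (π⁻¹_j).
-- Moving i from i₁ to i₂ flips the first comparison exactly when π⁻¹_{j−1} = ±p with i₁ ≤ p < i₂, and
-- the second exactly when π⁻¹_j is of that form, in the opposite direction. So ides σ changes iff exactly
-- one of π⁻¹_{j−1}, π⁻¹_j lies in ±[i₁, i₂), that is, iff exactly one square of that sign lies in
-- columns j − 1, j and rows i₁ … i₂ − 1.

open import Defs
open import Algebra.Bundles using (AbelianGroup)
open import Data.Bool using (Bool; true; false; if_then_else_)
open import Data.Empty using (⊥-elim)
open import Data.Integer as ℤ using (ℤ; +_; -[1+_]; -_; ∣_∣; +<+; -<+; -<-)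
import Data.Integer.Properties as ℤP
open import Algebra.Properties.Group (AbelianGroup.group ℤP.+-0-abelianGroup) using (∙-cancelʳ)
open import Data.List using (List; []; _∷_; map; length; upTo; applyUpTo)
import Data.List.Properties as List
open import Data.List.Membership.Propositional using (_∈_; _∉_)
import Data.List.Membership.Propositional.Properties as ∈
import Data.List.Relation.Unary.All as All
open import Data.List.Relation.Unary.AllPairs using (_∷_)
open import Data.List.Relation.Unary.Any using (here; there)
open import Data.List.Relation.Unary.Unique.Propositional using (Unique)
import Data.List.Relation.Unary.Unique.Propositional.Properties as Unique
open import Data.List.Relation.Binary.Permutation.Propositional using (↭-sym; ↭⇒↭ₛ)
import Data.List.Relation.Binary.Permutation.Propositional.Properties as ↭
open import Data.Nat as ℕ using (ℕ; zero; suc; _+_; _∸_; _≤_; _<_; _≡ᵇ_; z≤n; s≤s; _≤?_; _<?_)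
import Data.Nat.Properties as ℕP
open import Data.Nat.Tactic.RingSolver using (solve-∀)
open import Data.Product using (_×_; _,_; proj₁; proj₂; ∃-syntax)
open import Data.Product.Function.NonDependent.Propositional using (_×-cong_)
open import Data.Sum using (_⊎_; inj₁; inj₂)
open import Data.Sum.Function.Propositional using (_⊎-cong_)
open import Function using (_∘_)
open import Function.Bundles using (_⇔_; mk⇔; Equivalence)
import Function.Properties.Equivalence as ⇔
open import Function.Related.TypeIsomorphisms using (¬-cong-⇔)
open import Relation.Binary.Definitions using (tri<; tri≈; tri>)
open import Relation.Binary.PropositionalEquality
open import Data.List.Relation.Binary.Permutation.Setoid.Properties (setoid ℕ) using (Unique-resp-↭)
open import Relation.Nullary using (¬_; yes; no; does; proof)
open import Relation.Nullary.Decidable using (dec-true; dec-false; does-⇔)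
open import Relation.Nullary.Reflects using (Reflects; ofʸ; ofⁿ)

≡ᵇ-reflects : ∀ m k → Reflects (m ≡ k) (m ≡ᵇ k)
≡ᵇ-reflects m k = proof (m ℕ.≟ k)

≡ᵇ-true : ∀ {m k} → m ≡ k → (m ≡ᵇ k) ≡ true
≡ᵇ-true = dec-true (_ ℕ.≟ _)

≡ᵇ-false : ∀ {m k} → m ≢ k → (m ≡ᵇ k) ≡ false
≡ᵇ-false = dec-false (_ ℕ.≟ _)

≡ᵇ-⇔ : ∀ {m k m′ k′} → (m ≡ k) ⇔ (m′ ≡ k′) → (m ≡ᵇ k) ≡ (m′ ≡ᵇ k′)
≡ᵇ-⇔ eq = does-⇔ eq (_ ℕ.≟ _) (_ ℕ.≟ _)

+-cancelˡ-⇔ : ∀ c {x y} → (c + x ≡ c + y) ⇔ (x ≡ y)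
+-cancelˡ-⇔ c = mk⇔ (ℕP.+-cancelˡ-≡ c _ _) (cong (_+_ c))

+-cancelʳ-⇔ : ∀ {x y u v} → u ≡ v → (x + u ≡ y + v) ⇔ (x ≡ y)
+-cancelʳ-⇔ {u = u} refl = mk⇔ (ℕP.+-cancelʳ-≡ u _ _) (cong (_+ u))

+-cancelˡ-via : ∀ {x x′} c {y y′} → x ≡ c + y → x′ ≡ c + y′ → (x ≡ x′) ⇔ (y ≡ y′)
+-cancelˡ-via c refl refl = +-cancelˡ-⇔ c

+-interchange : ∀ c l u d → c + (l + (u + d)) ≡ (c + d) + (l + u)
+-interchange = solve-∀

-- Counting descents

_<ᵢ_ : ℤ → ℤ → ℕ
x <ᵢ y = if does (x ℤ.<? y) then 1 else 0

infix 5 _<ᵢ_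

<ᵢ-yes : ∀ {x y} → x ℤ.< y → x <ᵢ y ≡ 1
<ᵢ-yes {x} {y} x<y rewrite dec-true (x ℤ.<? y) x<y = refl

<ᵢ-no : ∀ {x y} → ¬ x ℤ.< y → x <ᵢ y ≡ 0
<ᵢ-no {x} {y} x≮y rewrite dec-false (x ℤ.<? y) x≮y = refl

descentAt : (ℕ → ℤ) → ℕ → ℕ
descentAt f k = f (suc k) <ᵢ f k

descents : (ℕ → ℤ) → ℕ → ℕ → ℕ
descents f a zero = 0
descents f a (suc N) = descentAt f a + descents f (suc a) N

descents-suc : ∀ f a N → descents f (suc a) N ≡ descents (f ∘ suc) a N
descents-suc f a zero = refl
descents-suc f a (suc N) = cong (_+_ (descentAt f (suc a))) (descents-suc f (suc a) N)

descents-+ : ∀ f a x y → descents f a (x + y) ≡ descents f a x + descents f (a + x) y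
descents-+ f a zero y rewrite ℕP.+-identityʳ a = refl
descents-+ f a (suc x) y rewrite descents-+ f (suc a) x y | ℕP.+-suc a x =
  sym (ℕP.+-assoc (descentAt f a) _ _)

descents-cong : ∀ {f g} a N → (∀ k → a ≤ k → k < a + N → descentAt f k ≡ descentAt g k) →
                descents f a N ≡ descents g a N
descents-cong a zero eq = refl
descents-cong a (suc N) eq =
  cong₂ _+_ (eq a ℕP.≤-refl (ℕP.m<m+n a ℕ.z<s))
            (descents-cong (suc a) N λ k a<k k< →
              eq k (ℕP.<⇒≤ a<k) (ℕP.<-≤-trans k< (ℕP.≤-reflexive (sym (ℕP.+-suc a N)))))

descentsFrom-applyUpTo : ∀ f N → descentsFrom (f 0) (applyUpTo (f ∘ suc) N) ≡ descents f 0 N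
descentsFrom-applyUpTo f zero = refl
descentsFrom-applyUpTo f (suc N) =
  cong (_+_ (descentAt f 0)) (trans (descentsFrom-applyUpTo (f ∘ suc) N) (sym (descents-suc f 0 N)))

-- Signed values and the relabelling shift

signed : Bool → ℕ → ℤ
signed b p = if b then + p else - (+ p)

nonneg : ℤ → Bool
nonneg x = does (+ 0 ℤ.≤? x)

∣signed∣ : ∀ b p → ∣ signed b p ∣ ≡ p
∣signed∣ true p = refl
∣signed∣ false zero = refl
∣signed∣ false (suc p) = refl

nonneg-signed : ∀ b {p} → 1 ≤ p → nonneg (signed b p) ≡ b
nonneg-signed true _ = refl
nonneg-signed false (s≤s _) = refl

signed-nonneg : ∀ x → signed (nonneg x) ∣ x ∣ ≡ x
signed-nonneg (+ p) = refl
signed-nonneg -[1+ m ] = refl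

signed≢0 : ∀ b {p} → 1 ≤ p → signed b p ≢ + 0
signed≢0 true (s≤s _) ()
signed≢0 false (s≤s _) ()

signed-injective : ∀ {b b′ p q} → 1 ≤ p → signed b p ≡ signed b′ q → b ≡ b′ × p ≡ q
signed-injective {true} {true} _ e = refl , ℤP.+-injective e
signed-injective {true} {false} {q = zero} (s≤s _) ()
signed-injective {true} {false} {q = suc q} (s≤s _) ()
signed-injective {false} {true} (s≤s _) ()
signed-injective {false} {false} {q = zero} (s≤s _) ()
signed-injective {false} {false} {q = suc q} (s≤s _) e = refl , cong suc (ℤP.-[1+-injective e)

bump : ℤ → ℤ
bump (+ p) = + suc p
bump -[1+ m ] = -[1+ suc m ]

shift-+-< : ∀ {t} p → p < t → shift t (+ p) ≡ + p
shift-+-< {t} p p<t rewrite dec-true (p <? t) p<t = refl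

shift-+-≥ : ∀ {t} p → t ≤ p → shift t (+ p) ≡ + suc p
shift-+-≥ {t} p t≤p rewrite dec-false (p <? t) (ℕP.≤⇒≯ t≤p) = cong +_ (ℕP.+-comm p 1)

shift-−-< : ∀ {t} m → suc m < t → shift t -[1+ m ] ≡ -[1+ m ]
shift-−-< {t} m m<t rewrite dec-true (suc m <? t) m<t = refl

shift-−-≥ : ∀ {t} m → t ≤ suc m → shift t -[1+ m ] ≡ -[1+ suc m ]
shift-−-≥ {t} m t≤m rewrite dec-false (suc m <? t) (ℕP.≤⇒≯ t≤m) =
  cong (λ z → -[1+ suc z ]) (ℕP.+-identityʳ m)

shift-view : ∀ j x → (∣ x ∣ < j × shift j x ≡ x) ⊎ (j ≤ ∣ x ∣ × shift j x ≡ bump x)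
shift-view j (+ p) with p <? j
... | yes p<j = inj₁ (p<j , shift-+-< p p<j)
... | no p≮j = inj₂ (ℕP.≮⇒≥ p≮j , shift-+-≥ p (ℕP.≮⇒≥ p≮j))
shift-view j -[1+ m ] with suc m <? j
... | yes m<j = inj₁ (m<j , shift-−-< m m<j)
... | no m≮j = inj₂ (ℕP.≮⇒≥ m≮j , shift-−-≥ m (ℕP.≮⇒≥ m≮j))

shift-signed-< : ∀ {t} b {p} → p < t → shift t (signed b p) ≡ signed b p
shift-signed-< true p<t = shift-+-< _ p<t
shift-signed-< false {zero} 0<t = shift-+-< 0 0<t
shift-signed-< false {suc p} p<t = shift-−-< p p<t

shift-signed-≥ : ∀ {t} b {p} → 1 ≤ t → t ≤ p → shift t (signed b p) ≡ signed b (suc p)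
shift-signed-≥ true _ t≤p = shift-+-≥ _ t≤p
shift-signed-≥ false {zero} 1≤t t≤0 = ⊥-elim (ℕP.1+n≰n (ℕP.≤-trans 1≤t t≤0))
shift-signed-≥ false {suc p} _ t≤p = shift-−-≥ p t≤p

nonneg-shift : ∀ j x → nonneg (shift j x) ≡ nonneg x
nonneg-shift j x with shift-view j x
nonneg-shift j x | inj₁ (_ , sx) rewrite sx = refl
nonneg-shift j (+ p) | inj₂ (_ , sx) rewrite sx = refl
nonneg-shift j -[1+ m ] | inj₂ (_ , sx) rewrite sx = refl

∣bump∣ : ∀ x → ∣ bump x ∣ ≡ suc ∣ x ∣
∣bump∣ (+ p) = refl
∣bump∣ -[1+ m ] = refl

∣shift∣≡-below : ∀ {j k} x → k < j → (∣ shift j x ∣ ≡ k) ⇔ (∣ x ∣ ≡ k)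
∣shift∣≡-below {j} x k<j with shift-view j x
... | inj₁ (_ , sx) rewrite sx = ⇔.refl
... | inj₂ (j≤x , sx) rewrite sx | ∣bump∣ x =
  mk⇔ (λ e → ⊥-elim (ℕP.<⇒≢ (ℕP.<-≤-trans k<j (ℕP.m≤n⇒m≤1+n j≤x)) (sym e)))
      (λ e → ⊥-elim (ℕP.<⇒≢ (ℕP.<-≤-trans k<j j≤x) (sym e)))

∣shift∣≡-above : ∀ {j k} x → j ≤ k → (∣ shift j x ∣ ≡ suc k) ⇔ (∣ x ∣ ≡ k)
∣shift∣≡-above {j} x j≤k with shift-view j x
... | inj₁ (x<j , sx) rewrite sx =
  mk⇔ (λ e → ⊥-elim (ℕP.<⇒≢ (ℕP.<-≤-trans x<j (ℕP.m≤n⇒m≤1+n j≤k)) e))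
      (λ e → ⊥-elim (ℕP.<⇒≢ (ℕP.<-≤-trans x<j j≤k) e))
... | inj₂ (_ , sx) rewrite sx | ∣bump∣ x = mk⇔ ℕP.suc-injective (cong suc)

∣shift∣≢ : ∀ j x → ∣ shift j x ∣ ≢ j
∣shift∣≢ j x with shift-view j x
... | inj₁ (x<j , sx) rewrite sx = ℕP.<⇒≢ x<j
... | inj₂ (j≤x , sx) rewrite sx | ∣bump∣ x = ℕP.>⇒≢ (s≤s j≤x)

bump-<-mono : ∀ {x y} → x ℤ.< y → bump x ℤ.< bump y
bump-<-mono (+<+ p<q) = +<+ (s≤s p<q)
bump-<-mono -<+ = -<+
bump-<-mono (-<- n<m) = -<- (s≤s n<m)

<-bump : ∀ {j x y} → ∣ x ∣ < j → j ≤ ∣ y ∣ → x ℤ.< y → x ℤ.< bump y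
<-bump {y = + q} _ _ x<y = ℤP.<-trans x<y (+<+ (ℕP.n<1+n q))
<-bump {x = -[1+ m ]} {y = -[1+ n ]} x<j j≤y (-<- n<m) =
  ⊥-elim (ℕP.<-asym (ℕP.<-≤-trans x<j j≤y) (s≤s n<m))

bump-< : ∀ {j x y} → j ≤ ∣ x ∣ → ∣ y ∣ < j → x ℤ.< y → bump x ℤ.< y
bump-< {x = -[1+ m ]} _ _ x<y = ℤP.<-trans (-<- (ℕP.n<1+n m)) x<y
bump-< {x = + p} {y = + q} j≤x y<j (+<+ p<q) =
  ⊥-elim (ℕP.<-asym (ℕP.<-≤-trans y<j j≤x) p<q)

shift-<-mono : ∀ j {x y} → x ℤ.< y → shift j x ℤ.< shift j y
shift-<-mono j {x} {y} x<y with shift-view j x | shift-view j y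
... | inj₁ (_ , sx) | inj₁ (_ , sy) rewrite sx | sy = x<y
... | inj₁ (x<j , sx) | inj₂ (j≤y , sy) rewrite sx | sy = <-bump x<j j≤y x<y
... | inj₂ (j≤x , sx) | inj₁ (y<j , sy) rewrite sx | sy = bump-< j≤x y<j x<y
... | inj₂ (_ , sx) | inj₂ (_ , sy) rewrite sx | sy = bump-<-mono x<y

shift-<-cancel : ∀ j {x y} → shift j x ℤ.< shift j y → x ℤ.< y
shift-<-cancel j {x} {y} lt with ℤP.<-cmp x y
... | tri< x<y _ _ = x<y
... | tri≈ _ refl _ = ⊥-elim (ℤP.<-irrefl refl lt)
... | tri> _ _ y<x = ⊥-elim (ℤP.<-asym lt (shift-<-mono j y<x))

<ᵢ-shift : ∀ j x y → shift j x <ᵢ shift j y ≡ x <ᵢ y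
<ᵢ-shift j x y =
  cong (λ b → if b then 1 else 0)
       (does-⇔ (mk⇔ (shift-<-cancel j) (shift-<-mono j)) (shift j x ℤ.<? shift j y) (x ℤ.<? y))

-- Entries of the inverse

invAt : List ℤ → ℕ → ℤ
invAt xs zero = + 0
invAt xs (suc k) = invEntry (suc k) 1 xs

idesB≡descents : ∀ xs → idesB xs ≡ descents (invAt xs) 0 (length xs)
idesB≡descents xs = begin
  descentsFrom (+ 0) (map (λ k → invEntry k 1 xs) (map suc (upTo (length xs))))
    ≡⟨ cong (descentsFrom (+ 0)) (sym (List.map-∘ (upTo (length xs)))) ⟩
  descentsFrom (+ 0) (map (invAt xs ∘ suc) (upTo (length xs)))
    ≡⟨ cong (descentsFrom (+ 0)) (List.map-applyUpTo (λ k → k) (invAt xs ∘ suc) (length xs)) ⟩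
  descentsFrom (+ 0) (applyUpTo (invAt xs ∘ suc) (length xs))
    ≡⟨ descentsFrom-applyUpTo (invAt xs) (length xs) ⟩
  descents (invAt xs) 0 (length xs) ∎
  where open ≡-Reasoning

invEntry-map : ∀ {f : ℤ → ℤ} {k k′} → (∀ x → (∣ f x ∣ ≡ k) ⇔ (∣ x ∣ ≡ k′)) →
               (∀ x → nonneg (f x) ≡ nonneg x) → ∀ p xs → invEntry k p (map f xs) ≡ invEntry k′ p xs
invEntry-map same-modulus same-sign p [] = refl
invEntry-map {k′ = k′} same-modulus same-sign p (x ∷ xs)
  rewrite ≡ᵇ-⇔ (same-modulus x) | same-sign x with ∣ x ∣ ≡ᵇ k′
... | true = refl
... | false = invEntry-map same-modulus same-sign (suc p) xs

invEntry-suc : ∀ {k t p} → 1 ≤ t → t ≤ p → ∀ xs → invEntry k (suc p) xs ≡ shift t (invEntry k p xs)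
invEntry-suc 1≤t t≤p [] = sym (shift-+-< 0 1≤t)
invEntry-suc {k} 1≤t t≤p (x ∷ xs) with ∣ x ∣ ≡ᵇ k
... | true = sym (shift-signed-≥ (nonneg x) 1≤t t≤p)
... | false = invEntry-suc 1≤t (ℕP.m≤n⇒m≤1+n t≤p) xs

invEntry-insertAt-≢ : ∀ {k v p} → ∣ v ∣ ≢ k → 1 ≤ p → ∀ m xs →
                      invEntry k p (insertAt m v xs) ≡ shift (p + m) (invEntry k p xs)
invEntry-insertAt-≢ {p = p} v≢k 1≤p zero xs rewrite ≡ᵇ-false v≢k | ℕP.+-identityʳ p =
  invEntry-suc 1≤p ℕP.≤-refl xs
invEntry-insertAt-≢ {p = p} v≢k 1≤p (suc m) [] rewrite ≡ᵇ-false v≢k =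
  sym (shift-+-< 0 (ℕP.≤-trans 1≤p (ℕP.m≤m+n p (suc m))))
invEntry-insertAt-≢ {k} {p = p} v≢k 1≤p (suc m) (x ∷ xs) with ∣ x ∣ ≡ᵇ k
... | true = sym (shift-signed-< (nonneg x) (ℕP.m<m+n p ℕ.z<s))
... | false rewrite ℕP.+-suc p m = invEntry-insertAt-≢ v≢k (ℕP.m≤n⇒m≤1+n 1≤p) m xs

invEntry-insertAt-fresh : ∀ {f : ℤ → ℤ} {k v} → ∣ v ∣ ≡ k → (∀ x → ∣ f x ∣ ≢ k) → ∀ p m xs → m ≤ length xs →
                          invEntry k p (insertAt m v (map f xs)) ≡ signed (nonneg v) (p + m)
invEntry-insertAt-fresh v≡k fresh p zero xs _ rewrite ≡ᵇ-true v≡k | ℕP.+-identityʳ p = refl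
invEntry-insertAt-fresh v≡k fresh p (suc m) (x ∷ xs) (s≤s m≤) rewrite ≡ᵇ-false (fresh x) | ℕP.+-suc p m =
  invEntry-insertAt-fresh v≡k fresh (suc p) m xs m≤

invEntry-∉ : ∀ {k p} xs → k ∉ map ∣_∣ xs → invEntry k p xs ≡ + 0
invEntry-∉ [] _ = refl
invEntry-∉ (x ∷ xs) k∉ rewrite ≡ᵇ-false (k∉ ∘ here ∘ sym) = invEntry-∉ xs (k∉ ∘ there)

at-∈ : ∀ xs r → at xs (suc r) ≢ + 0 → at xs (suc r) ∈ xs
at-∈ [] r nz = ⊥-elim (nz refl)
at-∈ (x ∷ xs) zero _ = here refl
at-∈ (x ∷ xs) (suc r) nz = there (at-∈ xs r nz)

at-length : ∀ xs r → at xs (suc r) ≢ + 0 → suc r ≤ length xs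
at-length [] r nz = ⊥-elim (nz refl)
at-length (x ∷ xs) zero _ = s≤s z≤n
at-length (x ∷ xs) (suc r) nz = s≤s (at-length xs r nz)

invEntry≡signed⇒at : ∀ {k b q} p xs → 1 ≤ p → 1 ≤ q → invEntry k p xs ≡ signed b q →
                     ∃[ r ] q ≡ p + r × at xs (suc r) ≡ signed b k
invEntry≡signed⇒at {b = b} p [] _ 1≤q e = ⊥-elim (signed≢0 b 1≤q (sym e))
invEntry≡signed⇒at {k} {b} p (x ∷ xs) 1≤p 1≤q e with ∣ x ∣ ≡ᵇ k | ≡ᵇ-reflects ∣ x ∣ k
... | true | ofʸ ∣x∣≡k with refl , refl ← signed-injective {b′ = b} 1≤p e =
  0 , sym (ℕP.+-identityʳ p) , trans (sym (signed-nonneg x)) (cong (signed (nonneg x)) ∣x∣≡k)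
... | false | ofⁿ _ with r , refl , at≡ ← invEntry≡signed⇒at (suc p) xs (s≤s z≤n) 1≤q e =
  suc r , sym (ℕP.+-suc p r) , at≡

at≡signed⇒invEntry : ∀ {b k} xs → Unique (map ∣_∣ xs) → 1 ≤ k → ∀ p r →
                     at xs (suc r) ≡ signed b k → invEntry k p xs ≡ signed b (p + r)
at≡signed⇒invEntry {b} {k} [] _ 1≤k p r e = ⊥-elim (signed≢0 b 1≤k (sym e))
at≡signed⇒invEntry {b} {k} (x ∷ xs) _ 1≤k p zero refl
  rewrite ∣signed∣ b k | ≡ᵇ-true {k} refl | nonneg-signed b 1≤k | ℕP.+-identityʳ p = refl
at≡signed⇒invEntry {b} {k} (x ∷ xs) (x-fresh ∷ u) 1≤k p (suc r) e with ∣ x ∣ ≡ᵇ k | ≡ᵇ-reflects ∣ x ∣ k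
... | true | ofʸ ∣x∣≡k =
  ⊥-elim (All.lookup x-fresh (∈.∈-map⁺ ∣_∣ (at-∈ xs r (signed≢0 b 1≤k ∘ trans (sym e))))
                     (trans ∣x∣≡k (sym (trans (cong ∣_∣ e) (∣signed∣ b k)))))
... | false | _ rewrite ℕP.+-suc p r = at≡signed⇒invEntry xs u 1≤k (suc p) r e

-- Inverting an insertion

-- insertion true and insertion false are φ and φbar definitionally; Square and dv below likewise
-- specialise to PosSquare, NegSquare and dvPlus, dvMinus.
insertion : Bool → ℕ → ℕ → List ℤ → List ℤ
insertion b i j π = insertAt (i ∸ 1) (signed b j) (map (shift j) π)

lowerBit upperBit : Bool → ℤ → ℕ → ℕ
lowerBit b x i = signed b i <ᵢ shift i x
upperBit b x i = shift i x <ᵢ signed b i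

module Insertion (b : Bool) (a j₀ : ℕ) {π : List ℤ} (a≤∣π∣ : a ≤ length π) where

  σ : List ℤ
  σ = insertion b (suc a) (suc j₀) π

  length-σ : length σ ≡ suc (length π)
  length-σ = trans (length-insertAt a (map (shift (suc j₀)) π))
                   (cong suc (List.length-map (shift (suc j₀)) π))
    where
    length-insertAt : ∀ m (ys : List ℤ) → length (insertAt m (signed b (suc j₀)) ys) ≡ suc (length ys)
    length-insertAt zero ys = refl
    length-insertAt (suc m) [] = refl
    length-insertAt (suc m) (y ∷ ys) = cong suc (length-insertAt m ys)

  invAt-below : ∀ k → k ≤ j₀ → invAt σ k ≡ shift (suc a) (invAt π k)
  invAt-below zero _ = refl
  invAt-below (suc k) k<j₀ =
    trans (invEntry-insertAt-≢ (ℕP.>⇒≢ (s≤s k<j₀) ∘ trans (sym (∣signed∣ b (suc j₀)))) (s≤s z≤n) a _)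
          (cong (shift (suc a))
                (invEntry-map (λ x → ∣shift∣≡-below x (s≤s k<j₀)) (nonneg-shift (suc j₀)) 1 π))

  invAt-inserted : invAt σ (suc j₀) ≡ signed b (suc a)
  invAt-inserted =
    trans (invEntry-insertAt-fresh (∣signed∣ b (suc j₀)) (∣shift∣≢ (suc j₀)) 1 a π a≤∣π∣)
          (cong (λ s → signed s (suc a)) (nonneg-signed b (s≤s z≤n)))

  invAt-above : ∀ k → suc j₀ ≤ k → invAt σ (suc k) ≡ shift (suc a) (invAt π k)
  invAt-above (suc k) (s≤s j₀≤k) =
    trans (invEntry-insertAt-≢ (ℕP.<⇒≢ (s≤s (s≤s j₀≤k)) ∘ trans (sym (∣signed∣ b (suc j₀)))) (s≤s z≤n) a _)
          (cong (shift (suc a))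
                (invEntry-map (λ x → ∣shift∣≡-above x (s≤s j₀≤k)) (nonneg-shift (suc j₀)) 1 π))

  descentAt-below : ∀ k → k < j₀ → descentAt (invAt σ) k ≡ descentAt (invAt π) k
  descentAt-below k k<j₀ =
    trans (cong₂ _<ᵢ_ (invAt-below (suc k) k<j₀) (invAt-below k (ℕP.<⇒≤ k<j₀)))
          (<ᵢ-shift (suc a) (invAt π (suc k)) (invAt π k))

  descentAt-lower : descentAt (invAt σ) j₀ ≡ lowerBit b (invAt π j₀) (suc a)
  descentAt-lower = cong₂ _<ᵢ_ invAt-inserted (invAt-below j₀ ℕP.≤-refl)

  descentAt-upper : descentAt (invAt σ) (suc j₀) ≡ upperBit b (invAt π (suc j₀)) (suc a)
  descentAt-upper = cong₂ _<ᵢ_ (invAt-above (suc j₀) ℕP.≤-refl) invAt-inserted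

  descentAt-above : ∀ k → suc j₀ ≤ k → descentAt (invAt σ) (suc k) ≡ descentAt (invAt π) k
  descentAt-above k j₀<k =
    trans (cong₂ _<ᵢ_ (invAt-above (suc k) (ℕP.m≤n⇒m≤1+n j₀<k)) (invAt-above k j₀<k))
          (<ᵢ-shift (suc a) (invAt π (suc k)) (invAt π k))

  descents-below : descents (invAt σ) 0 j₀ ≡ descents (invAt π) 0 j₀
  descents-below = descents-cong 0 j₀ λ k _ k<j₀ → descentAt-below k k<j₀

  descents-above : ∀ o → descents (invAt σ) (suc (suc j₀)) o ≡ descents (invAt π) (suc j₀) o
  descents-above o = trans (descents-suc (invAt σ) (suc j₀) o)
                           (descents-cong (suc j₀) o λ k j₀<k _ → descentAt-above k j₀<k)

  idesB-insertion : ∀ o → length π ≡ j₀ + suc o →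
    idesB σ ≡ (descents (invAt π) 0 j₀ + descents (invAt π) (suc j₀) o)
              + (lowerBit b (invAt π j₀) (suc a) + upperBit b (invAt π (suc j₀)) (suc a))
  idesB-insertion o ∣π∣≡ = begin
    idesB σ                                 ≡⟨ idesB≡descents σ ⟩
    descents (invAt σ) 0 (length σ)         ≡⟨ cong (descents (invAt σ) 0) ∣σ∣≡ ⟩
    descents (invAt σ) 0 (j₀ + (2 + o))     ≡⟨ descents-+ (invAt σ) 0 j₀ (2 + o) ⟩
    descents (invAt σ) 0 j₀
      + (descentAt (invAt σ) j₀ + (descentAt (invAt σ) (suc j₀) + descents (invAt σ) (2 + j₀) o))
      ≡⟨ cong₂ _+_ descents-below (cong₂ _+_ descentAt-lower (cong₂ _+_ descentAt-upper (descents-above o))) ⟩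
    descents (invAt π) 0 j₀ + (lower + (upper + descents (invAt π) (suc j₀) o))
      ≡⟨ +-interchange (descents (invAt π) 0 j₀) lower upper (descents (invAt π) (suc j₀) o) ⟩
    (descents (invAt π) 0 j₀ + descents (invAt π) (suc j₀) o) + (lower + upper) ∎
    where
    open ≡-Reasoning
    lower upper : ℕ
    lower = lowerBit b (invAt π j₀) (suc a)
    upper = upperBit b (invAt π (suc j₀)) (suc a)
    ∣σ∣≡ : length σ ≡ j₀ + (2 + o)
    ∣σ∣≡ = trans length-σ (trans (cong suc ∣π∣≡) (sym (ℕP.+-suc j₀ (suc o))))

  idesB-insertion-last : length π ≡ j₀ →
    idesB σ ≡ descents (invAt π) 0 j₀ + (lowerBit b (invAt π j₀) (suc a) + 0)
  idesB-insertion-last ∣π∣≡ = begin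
    idesB σ                                 ≡⟨ idesB≡descents σ ⟩
    descents (invAt σ) 0 (length σ)         ≡⟨ cong (descents (invAt σ) 0) ∣σ∣≡ ⟩
    descents (invAt σ) 0 (j₀ + 1)           ≡⟨ descents-+ (invAt σ) 0 j₀ 1 ⟩
    descents (invAt σ) 0 j₀ + (descentAt (invAt σ) j₀ + 0)
      ≡⟨ cong₂ _+_ descents-below (cong (_+ 0) descentAt-lower) ⟩
    descents (invAt π) 0 j₀ + (lowerBit b (invAt π j₀) (suc a) + 0) ∎
    where
    open ≡-Reasoning
    ∣σ∣≡ : length σ ≡ j₀ + 1
    ∣σ∣≡ = trans length-σ (trans (cong suc ∣π∣≡) (ℕP.+-comm 1 j₀))

-- Moving the insertion row

InRange : Bool → ℤ → ℕ → ℕ → Set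
InRange b x l h = ∃[ p ] x ≡ signed b p × l ≤ p × p < h

Xor : Set → Set → Set
Xor A B = (A × ¬ B) ⊎ (¬ A × B)

Jump : Set → ℕ → ℕ → Set
Jump A x y = (A × x ≡ 1 × y ≡ 0) ⊎ (¬ A × x ≡ y)

jump-resp : ∀ {A B x y} → A ⇔ B → Jump A x y → Jump B x y
jump-resp A⇔B (inj₁ (a , x≡1 , y≡0)) = inj₁ (Equivalence.to A⇔B a , x≡1 , y≡0)
jump-resp A⇔B (inj₂ (¬a , x≡y)) = inj₂ (¬a ∘ Equivalence.from A⇔B , x≡y)

jump-absent : ∀ {A x y} → ¬ A → x ≡ y → Jump A x y
jump-absent ¬a x≡y = inj₂ (¬a , x≡y)

jump-≤ : ∀ {l h p} (f : ℕ → ℕ) → (∀ {i} → i ≤ p → f i ≡ 1) → (∀ {i} → p < i → f i ≡ 0) →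
         l < h → Jump (l ≤ p × p < h) (f l) (f h)
jump-≤ {l} {h} {p} f f≡1 f≡0 l<h with l ≤? p | h ≤? p
... | yes l≤p | yes h≤p = inj₂ ((λ (_ , p<h) → ℕP.<⇒≱ p<h h≤p) , trans (f≡1 l≤p) (sym (f≡1 h≤p)))
... | yes l≤p | no h≰p = inj₁ ((l≤p , ℕP.≰⇒> h≰p) , f≡1 l≤p , f≡0 (ℕP.≰⇒> h≰p))
... | no l≰p | yes h≤p = ⊥-elim (l≰p (ℕP.≤-trans (ℕP.<⇒≤ l<h) h≤p))
... | no l≰p | no h≰p = inj₂ (l≰p ∘ proj₁ , trans (f≡0 (ℕP.≰⇒> l≰p)) (sym (f≡0 (ℕP.≰⇒> h≰p))))

jump-> : ∀ {l h p} (f : ℕ → ℕ) → (∀ {i} → p < i → f i ≡ 1) → (∀ {i} → i ≤ p → f i ≡ 0) →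
         l < h → Jump (l ≤ p × p < h) (f h) (f l)
jump-> {l} {h} {p} f f≡1 f≡0 l<h with p <? l | p <? h
... | yes p<l | _ = inj₂ ((λ (l≤p , _) → ℕP.<⇒≱ p<l l≤p) , trans (f≡1 (ℕP.<-trans p<l l<h)) (sym (f≡1 p<l)))
... | no p≮l | yes p<h = inj₁ ((ℕP.≮⇒≥ p≮l , p<h) , f≡1 p<h , f≡0 (ℕP.≮⇒≥ p≮l))
... | no p≮l | no p≮h = inj₂ (p≮h ∘ proj₂ , trans (f≡0 (ℕP.≮⇒≥ p≮h)) (sym (f≡0 (ℕP.≮⇒≥ p≮l))))

InRange-true-+ : ∀ {p l h} → InRange true (+ p) l h ⇔ (l ≤ p × p < h)
InRange-true-+ = mk⇔ (λ { (_ , refl , range) → range }) (λ range → _ , refl , range)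

InRange-true-− : ∀ {m l h} → ¬ InRange true -[1+ m ] l h
InRange-true-− (_ , () , _)

InRange-false-+ : ∀ {p l h} → 1 ≤ l → ¬ InRange false (+ p) l h
InRange-false-+ 1≤l (zero , refl , l≤0 , _) = ℕP.1+n≰n (ℕP.≤-trans 1≤l l≤0)

InRange-false-− : ∀ {m l h} → InRange false -[1+ m ] l h ⇔ (l ≤ suc m × suc m < h)
InRange-false-− = mk⇔ (λ { (suc _ , refl , range) → range }) (λ range → suc _ , refl , range)

lowerBit-true-≥ : ∀ {i p} → i ≤ p → lowerBit true (+ p) i ≡ 1
lowerBit-true-≥ {i} {p} i≤p = trans (cong ((+ i) <ᵢ_) (shift-+-≥ p i≤p)) (<ᵢ-yes (+<+ (s≤s i≤p)))

lowerBit-true-< : ∀ {i p} → p < i → lowerBit true (+ p) i ≡ 0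
lowerBit-true-< {i} {p} p<i =
  trans (cong ((+ i) <ᵢ_) (shift-+-< p p<i)) (<ᵢ-no {+ i} {+ p} λ { (+<+ i<p) → ℕP.<-asym i<p p<i })

lowerBit-true-− : ∀ {i m} → lowerBit true -[1+ m ] i ≡ 0
lowerBit-true-− {i} {m} with shift-view i -[1+ m ]
... | inj₁ (_ , sx) rewrite sx = refl
... | inj₂ (_ , sx) rewrite sx = refl

upperBit-true-< : ∀ {i q} → q < i → upperBit true (+ q) i ≡ 1
upperBit-true-< {i} {q} q<i = trans (cong (_<ᵢ (+ i)) (shift-+-< q q<i)) (<ᵢ-yes (+<+ q<i))

upperBit-true-≥ : ∀ {i q} → i ≤ q → upperBit true (+ q) i ≡ 0
upperBit-true-≥ {i} {q} i≤q =
  trans (cong (_<ᵢ (+ i)) (shift-+-≥ q i≤q))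
        (<ᵢ-no {+ suc q} {+ i} λ { (+<+ q<i) → ℕP.<⇒≱ q<i (ℕP.m≤n⇒m≤1+n i≤q) })

upperBit-true-− : ∀ {i m} → upperBit true -[1+ m ] i ≡ 1
upperBit-true-− {i} {m} with shift-view i -[1+ m ]
... | inj₁ (_ , sx) rewrite sx = refl
... | inj₂ (_ , sx) rewrite sx = refl

lowerBit-false-+ : ∀ {i p} → 1 ≤ i → lowerBit false (+ p) i ≡ 1
lowerBit-false-+ {suc i} {p} _ with shift-view (suc i) (+ p)
... | inj₁ (_ , sx) rewrite sx = refl
... | inj₂ (_ , sx) rewrite sx = refl

lowerBit-false-< : ∀ {i m} → suc m < i → lowerBit false -[1+ m ] i ≡ 1
lowerBit-false-< {suc i} {m} m<i =
  trans (cong (-[1+ i ] <ᵢ_) (shift-−-< m m<i)) (<ᵢ-yes (-<- (ℕ.s≤s⁻¹ m<i)))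

lowerBit-false-≥ : ∀ {i m} → i ≤ suc m → lowerBit false -[1+ m ] i ≡ 0
lowerBit-false-≥ {zero} _ = refl
lowerBit-false-≥ {suc i} {m} i≤m =
  trans (cong (-[1+ i ] <ᵢ_) (shift-−-≥ m i≤m))
        (<ᵢ-no { -[1+ i ]} { -[1+ suc m ]} λ { (-<- m<i) → ℕP.<-asym m<i i≤m })

upperBit-false-+ : ∀ {i q} → 1 ≤ i → upperBit false (+ q) i ≡ 0
upperBit-false-+ {suc i} {q} _ with shift-view (suc i) (+ q)
... | inj₁ (_ , sx) rewrite sx = refl
... | inj₂ (_ , sx) rewrite sx = refl

upperBit-false-≤ : ∀ {i m} → i ≤ suc m → upperBit false -[1+ m ] i ≡ 1
upperBit-false-≤ {zero} _ = refl
upperBit-false-≤ {suc i} {m} i≤m =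
  trans (cong (_<ᵢ -[1+ i ]) (shift-−-≥ m i≤m)) (<ᵢ-yes (-<- i≤m))

upperBit-false-> : ∀ {i m} → suc m < i → upperBit false -[1+ m ] i ≡ 0
upperBit-false-> {suc i} {m} m<i =
  trans (cong (_<ᵢ -[1+ i ]) (shift-−-< m m<i))
        (<ᵢ-no { -[1+ m ]} { -[1+ i ]} λ { (-<- i<m) → ℕP.<-asym i<m (ℕ.s≤s⁻¹ m<i) })

lowerBit-true-jump : ∀ {l h} → l < h → ∀ x → Jump (InRange true x l h) (lowerBit true x l) (lowerBit true x h)
lowerBit-true-jump l<h (+ p) =
  jump-resp (⇔.sym InRange-true-+) (jump-≤ (lowerBit true (+ p)) lowerBit-true-≥ lowerBit-true-< l<h)
lowerBit-true-jump {l} {h} l<h -[1+ m ] =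
  jump-absent InRange-true-− (trans (lowerBit-true-− {l}) (sym (lowerBit-true-− {h})))

upperBit-true-jump : ∀ {l h} → l < h → ∀ x → Jump (InRange true x l h) (upperBit true x h) (upperBit true x l)
upperBit-true-jump l<h (+ q) =
  jump-resp (⇔.sym InRange-true-+) (jump-> (upperBit true (+ q)) upperBit-true-< upperBit-true-≥ l<h)
upperBit-true-jump {l} {h} l<h -[1+ m ] =
  jump-absent InRange-true-− (trans (upperBit-true-− {h}) (sym (upperBit-true-− {l})))

lowerBit-false-jump : ∀ {l h} → 1 ≤ l → l < h → ∀ x →
                      Jump (InRange false x l h) (lowerBit false x h) (lowerBit false x l)
lowerBit-false-jump 1≤l l<h (+ p) =
  jump-absent (InRange-false-+ 1≤l)
              (trans (lowerBit-false-+ (ℕP.<-trans 1≤l l<h)) (sym (lowerBit-false-+ 1≤l)))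
lowerBit-false-jump 1≤l l<h -[1+ m ] =
  jump-resp (⇔.sym InRange-false-−) (jump-> (lowerBit false -[1+ m ]) lowerBit-false-< lowerBit-false-≥ l<h)

upperBit-false-jump : ∀ {l h} → 1 ≤ l → l < h → ∀ x →
                      Jump (InRange false x l h) (upperBit false x l) (upperBit false x h)
upperBit-false-jump 1≤l l<h (+ q) =
  jump-absent (InRange-false-+ 1≤l)
              (trans (upperBit-false-+ 1≤l) (sym (upperBit-false-+ (ℕP.<-trans 1≤l l<h))))
upperBit-false-jump 1≤l l<h -[1+ m ] =
  jump-resp (⇔.sym InRange-false-−) (jump-≤ (upperBit false -[1+ m ]) upperBit-false-≤ upperBit-false-> l<h)

jumps-≢⇔Xor : ∀ {A B u₁ u₂ w₁ w₂} → Jump A u₁ u₂ → Jump B w₂ w₁ → (u₁ + w₁ ≢ u₂ + w₂) ⇔ Xor A B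
jumps-≢⇔Xor (inj₁ (a , refl , refl)) (inj₁ (b , refl , refl)) =
  mk⇔ (λ 1≢1 → ⊥-elim (1≢1 refl)) λ { (inj₁ (_ , ¬b)) → ⊥-elim (¬b b) ; (inj₂ (¬a , _)) → ⊥-elim (¬a a) }
jumps-≢⇔Xor (inj₁ (a , refl , refl)) (inj₂ (¬b , refl)) = mk⇔ (λ _ → inj₁ (a , ¬b)) (λ _ → ℕP.1+n≢n)
jumps-≢⇔Xor (inj₂ (¬a , refl)) (inj₁ (b , refl , refl)) =
  mk⇔ (λ _ → inj₂ (¬a , b)) (λ _ u+0≡u+1 → ℕP.0≢1+n (ℕP.+-cancelˡ-≡ _ 0 1 u+0≡u+1))
jumps-≢⇔Xor (inj₂ (¬a , refl)) (inj₂ (¬b , refl)) =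
  mk⇔ (λ u≢u → ⊥-elim (u≢u refl)) λ { (inj₁ (a , _)) → ⊥-elim (¬a a) ; (inj₂ (_ , b)) → ⊥-elim (¬b b) }

upperBit-+0 : ∀ b {a₁ a₂} → upperBit b (+ 0) (suc a₁) ≡ upperBit b (+ 0) (suc a₂)
upperBit-+0 true = refl
upperBit-+0 false = refl

bits-≢⇔Xor : ∀ b x y {l h} → 1 ≤ l → l < h →
  (lowerBit b x l + upperBit b y l ≢ lowerBit b x h + upperBit b y h)
  ⇔ Xor (InRange b x l h) (InRange b y l h)
bits-≢⇔Xor true x y _ l<h = jumps-≢⇔Xor (lowerBit-true-jump l<h x) (upperBit-true-jump l<h y)
bits-≢⇔Xor false x y 1≤l l<h =
  ⇔.trans (mk⇔ ≢-sym ≢-sym) (jumps-≢⇔Xor (lowerBit-false-jump 1≤l l<h x) (upperBit-false-jump 1≤l l<h y))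

-- Squares of the grid

Square : Bool → ℕ → List ℤ → ℕ → ℕ → Set
Square b n π i′ j′ = 1 ≤ i′ × i′ ≤ n × 1 ≤ j′ × at π i′ ≡ signed b j′

Occupied : (ℕ → ℕ → Set) → ℕ → ℕ → ℕ → Set
Occupied S l h k = ∃[ i ] S i k × l ≤ i × i < h

exactlyOne-twoColumns⇔Xor : ∀ {S : ℕ → ℕ → Set} → (∀ {p q k} → S p k → S q k → p ≡ q) → ∀ c l h →
  ExactlyOneSquare (λ i k → S i k × InRegion (suc c) l h i k)
  ⇔ Xor (Occupied S l h c) (Occupied S l h (suc c))
exactlyOne-twoColumns⇔Xor {S} functional c l h = mk⇔ to from
  where
  P : ℕ → ℕ → Set
  P i k = S i k × InRegion (suc c) l h i k

  column : ∀ {i k} → InRegion (suc c) l h i k → k ≡ c ⊎ k ≡ suc c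
  column (c≤k , k≤c+1 , _) with ℕP.m≤n⇒m<n∨m≡n k≤c+1
  ... | inj₁ k<c+1 = inj₁ (ℕP.≤-antisym (ℕ.s≤s⁻¹ k<c+1) c≤k)
  ... | inj₂ k≡c+1 = inj₂ k≡c+1

  in-this : ∀ {i} → S i c → l ≤ i → i < h → P i c
  in-this s l≤i i<h = s , ℕP.≤-refl , ℕP.n≤1+n c , l≤i , i<h

  in-next : ∀ {i} → S i (suc c) → l ≤ i → i < h → P i (suc c)
  in-next s l≤i i<h = s , ℕP.n≤1+n c , ℕP.≤-refl , l≤i , i<h

  to : ExactlyOneSquare P → Xor (Occupied S l h c) (Occupied S l h (suc c))
  to ((i , k) , (s , reg@(_ , _ , l≤i , i<h)) , unique) with column reg
  ... | inj₁ refl = inj₁ ((i , s , l≤i , i<h) ,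
    λ (_ , s′ , l≤i′ , i′<h) → ℕP.1+n≢n (sym (cong proj₂ (unique (in-next s′ l≤i′ i′<h)))))
  ... | inj₂ refl = inj₂ (
    (λ (_ , s′ , l≤i′ , i′<h) → ℕP.1+n≢n (cong proj₂ (unique (in-this s′ l≤i′ i′<h)))) ,
    (i , s , l≤i , i<h))

  from : Xor (Occupied S l h c) (Occupied S l h (suc c)) → ExactlyOneSquare P
  from (inj₁ ((i , s , l≤i , i<h) , ¬next)) = (i , c) , in-this s l≤i i<h , unique
    where
    unique : ∀ {ik} → P (proj₁ ik) (proj₂ ik) → (i , c) ≡ ik
    unique (s′ , reg@(_ , _ , l≤i′ , i′<h)) with column reg
    ... | inj₁ refl = cong (_, c) (functional s s′)
    ... | inj₂ refl = ⊥-elim (¬next (_ , s′ , l≤i′ , i′<h))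
  from (inj₂ (¬this , (i , s , l≤i , i<h))) = (i , suc c) , in-next s l≤i i<h , unique
    where
    unique : ∀ {ik} → P (proj₁ ik) (proj₂ ik) → (i , suc c) ≡ ik
    unique (s′ , reg@(_ , _ , l≤i′ , i′<h)) with column reg
    ... | inj₁ refl = ⊥-elim (¬this (_ , s′ , l≤i′ , i′<h))
    ... | inj₂ refl = cong (_, suc c) (functional s s′)

Xor-cong : ∀ {A A′ B B′ : Set} → A ⇔ A′ → B ⇔ B′ → Xor A B ⇔ Xor A′ B′
Xor-cong A⇔ B⇔ = (A⇔ ×-cong ¬-cong-⇔ B⇔) ⊎-cong (¬-cong-⇔ A⇔ ×-cong B⇔)

module SignedPermutation {n : ℕ} {π : List ℤ} (perm : IsSignedPerm n π) where

  length≡n : length π ≡ n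
  length≡n = begin
    length π                  ≡⟨ List.length-map ∣_∣ π ⟨
    length (map ∣_∣ π)        ≡⟨ ↭.↭-length perm ⟩
    length (map suc (upTo n)) ≡⟨ List.length-map suc (upTo n) ⟩
    length (upTo n)           ≡⟨ List.length-upTo n ⟩
    n                         ∎
    where open ≡-Reasoning

  moduli-unique : Unique (map ∣_∣ π)
  moduli-unique = Unique-resp-↭ (↭⇒↭ₛ (↭-sym perm)) (Unique.map⁺ ℕP.suc-injective (Unique.upTo⁺ n))

  invAt-suc-n : invAt π (suc n) ≡ + 0
  invAt-suc-n = invEntry-∉ π λ n+1∈ →
    let (k , k∈ , n≡k) = ∈.∈-map⁻ suc (↭.∈-resp-↭ perm n+1∈) in
    ℕP.<-irrefl (sym (ℕP.suc-injective n≡k)) (∈.∈-upTo⁻ k∈)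

  invAt≡signed⇔Square : ∀ b {p} k → 1 ≤ p → (invAt π k ≡ signed b p) ⇔ Square b n π p k
  invAt≡signed⇔Square b {p} k 1≤p = mk⇔ (to k) (from k)
    where
    to : ∀ k → invAt π k ≡ signed b p → Square b n π p k
    to zero 0≡p = ⊥-elim (signed≢0 b 1≤p (sym 0≡p))
    to (suc k) e with r , refl , at≡ ← invEntry≡signed⇒at 1 π ℕP.≤-refl 1≤p e =
      1≤p , subst (suc r ≤_) length≡n (at-length π r (signed≢0 b (s≤s z≤n) ∘ trans (sym at≡))) , s≤s z≤n , at≡
    from : ∀ k → Square b n π p k → invAt π k ≡ signed b p
    from (suc k) (s≤s {n = r} z≤n , _ , 1≤k , at≡) = at≡signed⇒invEntry π moduli-unique 1≤k 1 r at≡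

  Square-functional : ∀ b {p q k} → Square b n π p k → Square b n π q k → p ≡ q
  Square-functional b {k = k} sp sq =
    proj₂ (signed-injective (proj₁ sp) (trans (sym (from sp)) (from sq)))
    where
    from : ∀ {p} → Square b n π p k → invAt π k ≡ signed b p
    from sp = Equivalence.from (invAt≡signed⇔Square b k (proj₁ sp)) sp

  Occupied⇔InRange : ∀ b {l h} k → 1 ≤ l → Occupied (Square b n π) l h k ⇔ InRange b (invAt π k) l h
  Occupied⇔InRange b {l} k 1≤l = mk⇔
    (λ (p , sq , l≤p , p<h) → p , Equivalence.from (square⇔ l≤p) sq , l≤p , p<h)
    (λ (p , e , l≤p , p<h) → p , Equivalence.to (square⇔ l≤p) e , l≤p , p<h)
    where
    square⇔ : ∀ {p} → l ≤ p → (invAt π k ≡ signed b p) ⇔ Square b n π p k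
    square⇔ l≤p = invAt≡signed⇔Square b k (ℕP.≤-trans 1≤l l≤p)

  exactlyOneSquare⇔Xor : ∀ b c {l h} → 1 ≤ l →
    ExactlyOneSquare (λ i′ j′ → Square b n π i′ j′ × InRegion (suc c) l h i′ j′)
    ⇔ Xor (InRange b (invAt π c) l h) (InRange b (invAt π (suc c)) l h)
  exactlyOneSquare⇔Xor b c {l} {h} 1≤l =
    ⇔.trans (exactlyOne-twoColumns⇔Xor (Square-functional b) c l h)
            (Xor-cong (Occupied⇔InRange b c 1≤l) (Occupied⇔InRange b (suc c) 1≤l))

  idesB-insertion-≡⇔ : ∀ b {j₀ a₁ a₂} → j₀ ≤ n → a₁ ≤ n → a₂ ≤ n →
    (idesB (insertion b (suc a₁) (suc j₀) π) ≡ idesB (insertion b (suc a₂) (suc j₀) π))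
    ⇔ (lowerBit b (invAt π j₀) (suc a₁) + upperBit b (invAt π (suc j₀)) (suc a₁)
       ≡ lowerBit b (invAt π j₀) (suc a₂) + upperBit b (invAt π (suc j₀)) (suc a₂))
  idesB-insertion-≡⇔ b {j₀} {a₁} {a₂} j₀≤n a₁≤n a₂≤n = by-cases (ℕP.m≤n⇒m<n∨m≡n j₀≤n)
    where
    module I₁ = Insertion b a₁ j₀ {π} (subst (a₁ ≤_) (sym length≡n) a₁≤n)
    module I₂ = Insertion b a₂ j₀ {π} (subst (a₂ ≤_) (sym length≡n) a₂≤n)

    W : ℕ → ℕ
    W a = lowerBit b (invAt π j₀) (suc a) + upperBit b (invAt π (suc j₀)) (suc a)

    by-cases : j₀ < n ⊎ j₀ ≡ n → (idesB I₁.σ ≡ idesB I₂.σ) ⇔ (W a₁ ≡ W a₂)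
    by-cases (inj₁ j₀<n) with o , j₀+1+o≡n ← ℕP.m≤n⇒∃[o]m+o≡n j₀<n =
      +-cancelˡ-via (descents (invAt π) 0 j₀ + descents (invAt π) (suc j₀) o)
                    (I₁.idesB-insertion o ∣π∣≡) (I₂.idesB-insertion o ∣π∣≡)
      where
      ∣π∣≡ : length π ≡ j₀ + suc o
      ∣π∣≡ = trans length≡n (sym (trans (ℕP.+-suc j₀ o) j₀+1+o≡n))
    -- For j = n + 1 there is no descent position j in σ⁻¹; the upper bit compares ±i with
    -- π⁻¹_{n+1} = 0 and is the same for both rows, so it may be added on both sides.
    by-cases (inj₂ j₀≡n) =
      ⇔.trans (+-cancelˡ-via (descents (invAt π) 0 j₀)
                             (I₁.idesB-insertion-last ∣π∣≡) (I₂.idesB-insertion-last ∣π∣≡))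
              (⇔.trans (+-cancelʳ-⇔ {u = 0} refl) (⇔.sym (+-cancelʳ-⇔ upper₁≡upper₂)))
      where
      ∣π∣≡ : length π ≡ j₀
      ∣π∣≡ = trans length≡n (sym j₀≡n)
      upper₁≡upper₂ : upperBit b (invAt π (suc j₀)) (suc a₁) ≡ upperBit b (invAt π (suc j₀)) (suc a₂)
      upper₁≡upper₂ rewrite j₀≡n | invAt-suc-n = upperBit-+0 b

dv : Bool → List ℤ → ℕ → ℕ → ℤ
dv b π i j = + idesB (insertion b i j π) ℤ.- + idesB π

−-cancelʳ-⇔ : ∀ {x y} z → (+ x ℤ.- z ≡ + y ℤ.- z) ⇔ (x ≡ y)
−-cancelʳ-⇔ z = mk⇔ (ℤP.+-injective ∘ ∙-cancelʳ (- z) _ _) (cong (λ d → + d ℤ.- z))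

proposition3p9 : (n : ℕ) (π : List ℤ) → IsSignedPerm n π →
    (j i₁ i₂ : ℕ) → 1 ≤ j → j ≤ suc n → 1 ≤ i₁ → i₁ < i₂ → i₂ ≤ suc n →
    ((dvPlus π i₁ j ≢ dvPlus π i₂ j)
       ⇔ ExactlyOneSquare (λ i' j' → PosSquare n π i' j' × InRegion j i₁ i₂ i' j'))
    × ((dvMinus π i₁ j ≢ dvMinus π i₂ j)
       ⇔ ExactlyOneSquare (λ i' j' → NegSquare n π i' j' × InRegion j i₁ i₂ i' j'))
proposition3p9 n π perm (suc j₀) (suc a₁) (suc a₂) _ (s≤s j₀≤n) _ (s≤s a₁<a₂) (s≤s a₂≤n) =
  differ⇔exactlyOneSquare true , differ⇔exactlyOneSquare false
  where
  open SignedPermutation perm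

  differ⇔exactlyOneSquare : ∀ b → (dv b π (suc a₁) (suc j₀) ≢ dv b π (suc a₂) (suc j₀))
    ⇔ ExactlyOneSquare (λ i′ j′ → Square b n π i′ j′ × InRegion (suc j₀) (suc a₁) (suc a₂) i′ j′)
  differ⇔exactlyOneSquare b =
    ⇔.trans (¬-cong-⇔ (⇔.trans (−-cancelʳ-⇔ (+ idesB π))
                                (idesB-insertion-≡⇔ b j₀≤n (ℕP.<⇒≤ (ℕP.<-≤-trans a₁<a₂ a₂≤n)) a₂≤n)))
    (⇔.trans (bits-≢⇔Xor b (invAt π j₀) (invAt π (suc j₀)) (s≤s z≤n) (s≤s a₁<a₂))
             (⇔.sym (exactlyOneSquare⇔Xor b j₀ (s≤s z≤n))))
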